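{- Let $(X,R)$ be the 3-cyclic forcing network and let $G$ be a connected $X$-colored graph. Then, with forcing with propagation, the end state $\epsilon(\ell_0(G))$ is monochromatic: all vertices have the same color $i$ for some $i\in\{1,2,3\}$.
   Context: The 3-cyclic forcing network is $X=\{1,2,3\}$ with the ordered list of rules $R=(1\to 2,\,2\to 3,\,3\to 1)$. An $X$-colored graph is a finite simple graph with each vertex colored by an element of $X$. Applying a rule $a\to b$ in a forcing step means simultaneously recoloring with $a$ every vertex of color $b$ having a neighbor of color $a$; a propagating forcing step with rule $a\to b$ repeats forcing steps with that rule until no vertex of color $b$ has a neighbor of color $a$. The process with propagation applies propagating forcing steps with the rules in cyclic order $1\to2,2\to3,3\to1,1\to2,\dots$ until no rule can be applied (no edge joins a vertex of color $a$ with one of color $b$ for a rule $a\to b$); the final coloring is the end state $\epsilon(\ell_0(G))$ of the initial coloring $\ell_0(G)$. -}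

module Defs where

open import Data.Nat using (ℕ)
open import Data.Fin using (Fin; zero; suc)
open import Data.Fin.Properties using () renaming (_≟_ to _≟ᶠ_)
open import Data.Bool using (Bool; true; false; _∧_; if_then_else_)
open import Data.List using (allFin)
open import Data.Bool.ListAction using (any)
open import Data.Product using (Σ; _×_; ∃)
open import Relation.Nullary using (¬_)
open import Relation.Nullary.Decidable using (⌊_⌋)
open import Relation.Binary.PropositionalEquality using (_≡_; _≢_)
open import Relation.Binary.Construct.Closure.ReflexiveTransitive using (Star)

-- Colors: X = {1,2,3} is represented by Fin 3 (zero ↦ 1, suc zero ↦ 2, suc (suc zero) ↦ 3).
Color : Set
Color = Fin 3

record Graph (n : ℕ) : Set where
  field
    adj   : Fin n → Fin n → Bool
    sym   : ∀ u v → adj u v ≡ adj v u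
    irref : ∀ v → adj v v ≡ false
open Graph public

Edge : ∀ {n} → Graph n → Fin n → Fin n → Set
Edge G u v = adj G u v ≡ true

Connected : ∀ {n} → Graph n → Set
Connected {n} G = ∀ (u v : Fin n) → Star (Edge G) u v

Coloring : ℕ → Set
Coloring n = Fin n → Color

Rule : Set
Rule = Fin 3

src : Rule → Color
src k = k

tgt : Rule → Color
tgt zero = suc zero
tgt (suc zero) = suc (suc zero)
tgt (suc (suc zero)) = zero

nextRule : Rule → Rule
nextRule zero = suc zero
nextRule (suc zero) = suc (suc zero)
nextRule (suc (suc zero)) = zero

_==_ : Color → Color → Bool
a == b = ⌊ a ≟ᶠ b ⌋

hasNbr : ∀ {n} → Graph n → Coloring n → Fin n → Color → Bool
hasNbr {n} G c v a = any (λ u → adj G v u ∧ (c u == a)) (allFin n)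

forceStep : ∀ {n} → Graph n → Rule → Coloring n → Coloring n
forceStep G r c v =
  if (c v == tgt r) ∧ hasNbr G c v (src r) then src r else c v

Stable : ∀ {n} → Graph n → Rule → Coloring n → Set
Stable G r c = ∀ u v → Edge G u v → c u ≡ src r → c v ≢ tgt r

data PropStep {n} (G : Graph n) (r : Rule) : Coloring n → Coloring n → Set where
  done : ∀ {c} → Stable G r c → PropStep G r c c
  more : ∀ {c c'} → ¬ Stable G r c → PropStep G r (forceStep G r c) c' → PropStep G r c c'

Terminal : ∀ {n} → Graph n → Coloring n → Set
Terminal G c = ∀ r → Stable G r c

-- The process with propagation, currently about to apply rule r,
-- starting from c and ending (when no rule can be applied) at c'.
data Process {n} (G : Graph n) : Rule → Coloring n → Coloring n → Set where
  end : ∀ {r c} → Terminal G c → Process G r c c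
  go  : ∀ {r c c₁ c'} → ¬ Terminal G c → PropStep G r c c₁ →
        Process G (nextRule r) c₁ c' → Process G r c c'

-- c' is the end state ε(c) of the process started at c with the first rule 1→2.
EndState : ∀ {n} → Graph n → Coloring n → Coloring n → Set
EndState G c c' = Process G zero c c'

Monochromatic : ∀ {n} → Coloring n → Set
Monochromatic {n} c = ∃ λ (i : Color) → ∀ (v : Fin n) → c v ≡ i

-- A terminal coloring has no bichromatic edge, because any two distinct colors of the
-- 3-cyclic network are the two ends of some rule; on a connected graph it is therefore
-- constant. The process terminates: a propagating step with rule a → b ends after at
-- most as many forcing steps as there are vertices of color b, since each forcing step
-- recolors at least one of them and creates none. A propagating step that fires makes the
-- offending edge monochromatic and turns no monochromatic edge bichromatic (such an edge
-- would join the colors a and b after the step), so the number of bichromatic edges drops;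
-- and a non-terminal coloring is unstable for one of the next three rules.
module Submission where

open import Defs hiding (sym)
open import Data.Nat using (ℕ; zero; suc; _+_; _≤_; _<_; z≤n; s≤s)
open import Data.Nat.Properties using (≤-refl; +-mono-≤; +-mono-<-≤; +-mono-≤-<)
open import Data.Nat.Induction using (<-wellFounded)
open import Induction.WellFounded using (Acc; acc)
open import Data.Product using (_×_; ∃; Σ; _,_)
open import Data.Sum using (_⊎_; inj₁; inj₂)
open import Data.Fin using (Fin; zero; suc)
open import Data.Fin.Properties using (any?) renaming (_≟_ to _≟ᶠ_)
open import Data.Bool using (true; false; T)
open import Data.Bool.Properties using (T-∧; T-≡) renaming (_≟_ to _≟ᵇ_)
open import Data.List.Relation.Unary.Any.Properties using (any⁺)
open import Data.List.Membership.Propositional using (lose)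
open import Data.List.Membership.Propositional.Properties using (∈-allFin)
open import Data.Empty using (⊥-elim)
open import Function using (_∘_; id; Equivalence)
open import Relation.Nullary using (¬_; Dec; yes; no; ¬?)
open import Relation.Nullary.Decidable using (_×-dec_; fromWitness)
open import Relation.Binary.PropositionalEquality using (_≡_; _≢_; refl; sym; trans)
open import Relation.Binary.Construct.Closure.ReflexiveTransitive using (fold)

𝟙 : {A : Set} → Dec A → ℕ
𝟙 (yes _) = 1
𝟙 (no _)  = 0

𝟙-mono : {A B : Set} (a? : Dec A) (b? : Dec B) → (A → B) → 𝟙 a? ≤ 𝟙 b?
𝟙-mono (yes a) (yes _) f = ≤-refl
𝟙-mono (yes a) (no ¬b) f = ⊥-elim (¬b (f a))
𝟙-mono (no _)  _       f = z≤n

𝟙-mono-< : {A B : Set} (a? : Dec A) (b? : Dec B) → ¬ A → B → 𝟙 a? < 𝟙 b?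
𝟙-mono-< (yes a) _       ¬a b = ⊥-elim (¬a a)
𝟙-mono-< (no _)  (yes _) ¬a b = s≤s z≤n
𝟙-mono-< (no _)  (no ¬b) ¬a b = ⊥-elim (¬b b)

∑ : ∀ {n} → (Fin n → ℕ) → ℕ
∑ {zero}  f = 0
∑ {suc n} f = f zero + ∑ (f ∘ suc)

∑-mono : ∀ {n} {f g : Fin n → ℕ} → (∀ i → f i ≤ g i) → ∑ f ≤ ∑ g
∑-mono {zero}  f≤g = z≤n
∑-mono {suc n} f≤g = +-mono-≤ (f≤g zero) (∑-mono (f≤g ∘ suc))

∑-mono-< : ∀ {n} {f g : Fin n → ℕ} → (∀ i → f i ≤ g i) → ∀ k → f k < g k → ∑ f < ∑ g
∑-mono-< f≤g zero    fk<gk = +-mono-<-≤ fk<gk (∑-mono (f≤g ∘ suc))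
∑-mono-< f≤g (suc k) fk<gk = +-mono-≤-< (f≤g zero) (∑-mono-< (f≤g ∘ suc) k fk<gk)

src≢tgt : ∀ r → src r ≢ tgt r
src≢tgt zero             ()
src≢tgt (suc zero)       ()
src≢tgt (suc (suc zero)) ()

rule-between : ∀ {a b : Color} → a ≢ b →
               ∃ λ r → (src r ≡ a × tgt r ≡ b) ⊎ (src r ≡ b × tgt r ≡ a)
rule-between {zero}           {zero}           a≢b = ⊥-elim (a≢b refl)
rule-between {zero}           {suc zero}       _   = zero , inj₁ (refl , refl)
rule-between {zero}           {suc (suc zero)} _   = suc (suc zero) , inj₂ (refl , refl)
rule-between {suc zero}       {zero}           _   = zero , inj₂ (refl , refl)
rule-between {suc zero}       {suc zero}       a≢b = ⊥-elim (a≢b refl)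
rule-between {suc zero}       {suc (suc zero)} _   = suc zero , inj₁ (refl , refl)
rule-between {suc (suc zero)} {zero}           _   = suc (suc zero) , inj₁ (refl , refl)
rule-between {suc (suc zero)} {suc zero}       _   = suc zero , inj₂ (refl , refl)
rule-between {suc (suc zero)} {suc (suc zero)} a≢b = ⊥-elim (a≢b refl)

nextRule-cycle : ∀ r r′ → r′ ≡ r ⊎ r′ ≡ nextRule r ⊎ r′ ≡ nextRule (nextRule r)
nextRule-cycle zero             zero             = inj₁ refl
nextRule-cycle zero             (suc zero)       = inj₂ (inj₁ refl)
nextRule-cycle zero             (suc (suc zero)) = inj₂ (inj₂ refl)
nextRule-cycle (suc zero)       zero             = inj₂ (inj₂ refl)
nextRule-cycle (suc zero)       (suc zero)       = inj₁ refl
nextRule-cycle (suc zero)       (suc (suc zero)) = inj₂ (inj₁ refl)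
nextRule-cycle (suc (suc zero)) zero             = inj₂ (inj₁ refl)
nextRule-cycle (suc (suc zero)) (suc zero)       = inj₂ (inj₂ refl)
nextRule-cycle (suc (suc zero)) (suc (suc zero)) = inj₁ refl

Recolors : ∀ {n} → Rule → Coloring n → Coloring n → Set
Recolors r c c′ = ∀ v → c′ v ≡ c v ⊎ (c v ≡ tgt r × c′ v ≡ src r)

Recolors-refl : ∀ {n r} {c : Coloring n} → Recolors r c c
Recolors-refl v = inj₁ refl

Recolors-trans : ∀ {n r} {c₀ c₁ c₂ : Coloring n} →
                 Recolors r c₀ c₁ → Recolors r c₁ c₂ → Recolors r c₀ c₂
Recolors-trans {r = r} R₀₁ R₁₂ v with R₀₁ v | R₁₂ v
... | inj₁ e₀₁       | inj₁ e₁₂       = inj₁ (trans e₁₂ e₀₁)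
... | inj₁ e₀₁       | inj₂ (t₁ , s₂) = inj₂ (trans (sym e₀₁) t₁ , s₂)
... | inj₂ (t₀ , s₁) | inj₁ e₁₂       = inj₂ (t₀ , trans e₁₂ s₁)
... | inj₂ (_ , s₁)  | inj₂ (t₁ , _)  = ⊥-elim (src≢tgt r (trans (sym s₁) t₁))

#tgt : ∀ {n} → Rule → Coloring n → ℕ
#tgt r c = ∑ λ v → 𝟙 (c v ≟ᶠ tgt r)

#tgt-< : ∀ {n r} {c c′ : Coloring n} → Recolors r c c′ → ∀ {v} → c v ≡ tgt r → c′ v ≡ src r →
         #tgt r c′ < #tgt r c
#tgt-< {r = r} {c} {c′} R {v} cv c′v =
  ∑-mono-< (λ w → 𝟙-mono (c′ w ≟ᶠ tgt r) (c w ≟ᶠ tgt r) stays-tgt) v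
           (𝟙-mono-< (c′ v ≟ᶠ tgt r) (c v ≟ᶠ tgt r) (src≢tgt r ∘ trans (sym c′v)) cv)
  where
  stays-tgt : ∀ {w} → c′ w ≡ tgt r → c w ≡ tgt r
  stays-tgt {w} c′w with R w
  ... | inj₁ e        = trans (sym e) c′w
  ... | inj₂ (cw , _) = cw

module _ {n} (G : Graph n) where

  edge-sym : ∀ {u v} → Edge G u v → Edge G v u
  edge-sym {u} {v} e = trans (Graph.sym G v u) e

  Applicable : Rule → Coloring n → Set
  Applicable r c = Σ (Fin n) λ u → Σ (Fin n) λ v → Edge G u v × c u ≡ src r × c v ≡ tgt r

  applicable⇒¬stable : ∀ {r c} → Applicable r c → ¬ Stable G r c
  applicable⇒¬stable (u , v , e , cu , cv) s = s u v e cu cv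

  applicable⇒¬terminal : ∀ {r c} → Applicable r c → ¬ Terminal G c
  applicable⇒¬terminal {r} a t = applicable⇒¬stable a (t r)

  stable-or-applicable : ∀ r c → Stable G r c ⊎ Applicable r c
  stable-or-applicable r c
    with any? (λ u → any? (λ v → (adj G u v ≟ᵇ true) ×-dec ((c u ≟ᶠ src r) ×-dec (c v ≟ᶠ tgt r))))
  ... | yes (u , v , e , cu , cv) = inj₂ (u , v , e , cu , cv)
  ... | no ¬a                    = inj₁ λ u v e cu cv → ¬a (u , v , e , cu , cv)

  three-stable⇒terminal : ∀ {r c} → Stable G r c → Stable G (nextRule r) c →
                          Stable G (nextRule (nextRule r)) c → Terminal G c
  three-stable⇒terminal {r} s₀ s₁ s₂ r′ with nextRule-cycle r r′
  ... | inj₁ refl        = s₀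
  ... | inj₂ (inj₁ refl) = s₁
  ... | inj₂ (inj₂ refl) = s₂

  terminal⇒edge-monochromatic : ∀ {c} → Terminal G c → ∀ {u v} → Edge G u v → c u ≡ c v
  terminal⇒edge-monochromatic {c} t {u} {v} e with c u ≟ᶠ c v
  ... | yes cu≡cv = cu≡cv
  ... | no cu≢cv with rule-between cu≢cv
  ...   | r , inj₁ (s , g) = ⊥-elim (t r u v e (sym s) (sym g))
  ...   | r , inj₂ (s , g) = ⊥-elim (t r v u (edge-sym e) (sym s) (sym g))

  hasNbr-complete : ∀ {c : Coloring n} {v u a} → Edge G v u → c u ≡ a → T (hasNbr G c v a)
  hasNbr-complete {u = u} e cu =
    any⁺ _ (lose (∈-allFin u) (Equivalence.from T-∧ (Equivalence.from T-≡ e , fromWitness cu)))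

  forceStep-recolors : ∀ r c → Recolors r c (forceStep G r c)
  forceStep-recolors r c v with c v ≟ᶠ tgt r | hasNbr G c v (src r)
  ... | yes cv | true  = inj₂ (cv , refl)
  ... | yes _  | false = inj₁ refl
  ... | no _   | _     = inj₁ refl

  forceStep-forces : ∀ {r c u v} → Edge G u v → c u ≡ src r → c v ≡ tgt r → forceStep G r c v ≡ src r
  forceStep-forces {r} {c} {v = v} e cu cv
    with c v ≟ᶠ tgt r | hasNbr G c v (src r) | hasNbr-complete {c} (edge-sym e) cu
  ... | yes _  | true  | _  = refl
  ... | yes _  | false | ()
  ... | no ¬cv | _     | _  = ⊥-elim (¬cv cv)

  propagate : ∀ r c → Σ (Coloring n) λ c′ → PropStep G r c c′ × Recolors r c c′ × Stable G r c′
  propagate r c = propagate-acc c (<-wellFounded (#tgt r c))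
    where
    propagate-acc : ∀ c → Acc _<_ (#tgt r c) →
                    Σ (Coloring n) λ c′ → PropStep G r c c′ × Recolors r c c′ × Stable G r c′
    propagate-acc c (acc rec) with stable-or-applicable r c
    ... | inj₁ s = c , done s , Recolors-refl , s
    ... | inj₂ a@(u , v , e , cu , cv)
      with propagate-acc (forceStep G r c)
                         (rec (#tgt-< (forceStep-recolors r c) cv (forceStep-forces e cu cv)))
    ...   | c′ , p , R , s =
      c′ , more (applicable⇒¬stable a) p , Recolors-trans (forceStep-recolors r c) R , s

  bichromatic? : ∀ (c : Coloring n) u v → Dec (Edge G u v × c u ≢ c v)
  bichromatic? c u v = (adj G u v ≟ᵇ true) ×-dec ¬? (c u ≟ᶠ c v)

  #bichromatic : Coloring n → ℕ
  #bichromatic c = ∑ λ u → ∑ λ v → 𝟙 (bichromatic? c u v)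

  recoloring-keeps-monochromatic : ∀ {r c c′} → Recolors r c c′ → Stable G r c′ →
                                   ∀ {u v} → Edge G u v → c u ≡ c v → c′ u ≡ c′ v
  recoloring-keeps-monochromatic {r} R s {u} {v} e cu≡cv with R u | R v
  ... | inj₁ eu        | inj₁ ev        = trans eu (trans cu≡cv (sym ev))
  ... | inj₁ eu        | inj₂ (tv , sv) = ⊥-elim (s v u (edge-sym e) sv (trans eu (trans cu≡cv tv)))
  ... | inj₂ (tu , su) | inj₁ ev        = ⊥-elim (s u v e su (trans ev (trans (sym cu≡cv) tu)))
  ... | inj₂ (_ , su)  | inj₂ (_ , sv)  = trans su (sym sv)

  applicable-edge-closes : ∀ {r c c′} → Recolors r c c′ → Stable G r c′ →
                           ∀ {u v} → Edge G u v → c u ≡ src r → c v ≡ tgt r → c′ u ≡ c′ v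
  applicable-edge-closes {r} R s {u} {v} e cu cv with R u | R v
  ... | inj₂ (tu , _) | _             = ⊥-elim (src≢tgt r (trans (sym cu) tu))
  ... | inj₁ eu       | inj₁ ev       = ⊥-elim (s u v e (trans eu cu) (trans ev cv))
  ... | inj₁ eu       | inj₂ (_ , sv) = trans eu (trans cu (sym sv))

  #bichromatic-< : ∀ {r c c′} → Recolors r c c′ → Stable G r c′ → Applicable r c →
                   #bichromatic c′ < #bichromatic c
  #bichromatic-< {r} {c} {c′} R s (u , v , e , cu , cv) =
    ∑-mono-< (λ x → ∑-mono (λ y → bichromatic-mono x y)) u
      (∑-mono-< (bichromatic-mono u) v
        (𝟙-mono-< (bichromatic? c′ u v) (bichromatic? c u v)
                  (λ (_ , c′u≢c′v) → c′u≢c′v (applicable-edge-closes R s e cu cv))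
                  (e , λ cu≡cv → src≢tgt r (trans (sym cu) (trans cu≡cv cv)))))
    where
    bichromatic-mono : ∀ x y → 𝟙 (bichromatic? c′ x y) ≤ 𝟙 (bichromatic? c x y)
    bichromatic-mono x y = 𝟙-mono (bichromatic? c′ x y) (bichromatic? c x y)
      λ (exy , c′x≢c′y) → exy , c′x≢c′y ∘ recoloring-keeps-monochromatic R s exy

  next-applicable : ∀ r c → Terminal G c ⊎
    Σ Rule λ r′ → Applicable r′ c × (∀ {c′} → Process G r′ c c′ → Process G r c c′)
  next-applicable r c with stable-or-applicable r c
  ... | inj₂ a = inj₂ (r , a , id)
  ... | inj₁ s₀ with stable-or-applicable (nextRule r) c
  ...   | inj₂ a = inj₂ (nextRule r , a , go (applicable⇒¬terminal a) (done s₀))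
  ...   | inj₁ s₁ with stable-or-applicable (nextRule (nextRule r)) c
  ...     | inj₂ a = inj₂ (nextRule (nextRule r) , a ,
                          go (applicable⇒¬terminal a) (done s₀) ∘ go (applicable⇒¬terminal a) (done s₁))
  ...     | inj₁ s₂ = inj₁ (three-stable⇒terminal s₀ s₁ s₂)

  process : ∀ r c → ∃ λ c′ → Process G r c c′
  process r c = process-acc r c (<-wellFounded (#bichromatic c))
    where
    process-acc : ∀ r c → Acc _<_ (#bichromatic c) → ∃ λ c′ → Process G r c c′
    process-acc r c (acc rec) with next-applicable r c
    ... | inj₁ t = c , end t
    ... | inj₂ (r′ , a , skip) with propagate r′ c
    ...   | c₁ , p , R , s with process-acc (nextRule r′) c₁ (rec (#bichromatic-< R s a))
    ...     | c′ , q = c′ , skip (go (applicable⇒¬terminal a) p q)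

process-terminal : ∀ {n} {G : Graph n} {r c c′} → Process G r c c′ → Terminal G c′
process-terminal (end t)    = t
process-terminal (go _ _ p) = process-terminal p

connected⇒monochromatic : ∀ {n} {G : Graph n} {c : Coloring n} → Connected G →
                          (∀ {u v} → Edge G u v → c u ≡ c v) → Monochromatic c
connected⇒monochromatic {zero}          conn edge-mono = zero , λ ()
connected⇒monochromatic {suc n} {c = c} conn edge-mono =
  c zero , λ v → sym (fold (λ u v → c u ≡ c v) (trans ∘ edge-mono) refl (conn zero v))

lemma4p2 : ∀ (n : ℕ) (G : Graph n) (ℓ₀ : Coloring n) → Connected G →
    (∃ λ ε → EndState G ℓ₀ ε) × (∀ ε → EndState G ℓ₀ ε → Monochromatic ε)
lemma4p2 n G ℓ₀ conn =
  process G zero ℓ₀ ,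
  λ ε p → connected⇒monochromatic {G = G} conn (terminal⇒edge-monochromatic G (process-terminal p))
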